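{- Let $\mathbf{C}:\mathcal{C}\to\mathcal{B}$ be a 1-discrete 2-fibration. Let $f:A\to B$, $g:B\to C$, $h:A\to C$ be 1-cells in $\mathcal{B}$ and $\alpha:h\Rightarrow gf$ a 2-cell. Let $q:Q\to R$ be a cartesian 1-cell over $g$ and $r:P\to R$ a 1-cell over $h$. Then there exists a unique 1-cell $p:P\to Q$ over $f$ for which there exists a 2-cell $r\Rightarrow qp$ over $\alpha$; moreover such a 2-cell is unique.
   Context: A 2-functor is a strict homomorphism of 2-categories (preserving 0-, 1- and 2-cells and all compositions and identities). A pre-2-fibration is a 2-functor $\mathbf{C}:\mathcal{C}\to\mathcal{B}$; cells of $\mathcal{C}$ lie over their images. It is a 1-discrete 2-fibration if (i) its underlying functor of 1-categories is a Grothendieck fibration, and (ii) for every 2-cell $\alpha:f\Rightarrow g$ in $\mathcal{B}$ and every 1-cell $p$ in $\mathcal{C}$ over $f$, there is a unique 2-cell in $\mathcal{C}$ over $\alpha$ with domain $p$. A 1-cell $q:Q\to R$ over $g$ is cartesian (with respect to the underlying 1-categorical functor) if for every 1-cell $r:P\to R$ over $g\circ f$ there is a unique $p:P\to Q$ over $f$ with $qp=r$. -}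

module Defs where

open import Level using (Level; _⊔_) renaming (suc to lsuc)
import Data.Product
open import Data.Product using (Σ; _,_; _×_; ∃; ∃!)
open import Relation.Binary.PropositionalEquality using (_≡_; subst₂)

record TwoCategory (o h c : Level) : Set (lsuc (o ⊔ h ⊔ c)) where
  infixr 9 _∘₁_
  infixr 9 _·_
  infixr 9 _◆_
  field
    Obj  : Set o
    Hom  : Obj → Obj → Set h
    Cell : {A B : Obj} → Hom A B → Hom A B → Set c
    id₁  : ∀ {A} → Hom A A
    _∘₁_ : ∀ {A B C} → Hom B C → Hom A B → Hom A C
    id₂  : ∀ {A B} {f : Hom A B} → Cell f f
    _·_  : ∀ {A B} {f g k : Hom A B} → Cell g k → Cell f g → Cell f k
    _◆_  : ∀ {A B C} {f f' : Hom A B} {g g' : Hom B C} →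
           Cell g g' → Cell f f' → Cell (g ∘₁ f) (g' ∘₁ f')
    ∘₁-assoc : ∀ {A B C D} {f : Hom A B} {g : Hom B C} {k : Hom C D} →
               (k ∘₁ g) ∘₁ f ≡ k ∘₁ (g ∘₁ f)
    ∘₁-idˡ : ∀ {A B} {f : Hom A B} → id₁ ∘₁ f ≡ f
    ∘₁-idʳ : ∀ {A B} {f : Hom A B} → f ∘₁ id₁ ≡ f
    ·-assoc : ∀ {A B} {f g k l : Hom A B} {α : Cell f g} {β : Cell g k} {γ : Cell k l} →
              (γ · β) · α ≡ γ · (β · α)
    ·-idˡ : ∀ {A B} {f g : Hom A B} {α : Cell f g} → id₂ · α ≡ α
    ·-idʳ : ∀ {A B} {f g : Hom A B} {α : Cell f g} → α · id₂ ≡ α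
    ◆-id : ∀ {A B C} {f : Hom A B} {g : Hom B C} →
           id₂ {f = g} ◆ id₂ {f = f} ≡ id₂
    interchange : ∀ {A B C} {f f' f'' : Hom A B} {g g' g'' : Hom B C}
                  {α : Cell f f'} {α' : Cell f' f''} {β : Cell g g'} {β' : Cell g' g''} →
                  (β' · β) ◆ (α' · α) ≡ (β' ◆ α') · (β ◆ α)
    ◆-assoc : ∀ {A B C D} {f f' : Hom A B} {g g' : Hom B C} {k k' : Hom C D}
              {α : Cell f f'} {β : Cell g g'} {γ : Cell k k'} →
              subst₂ Cell ∘₁-assoc ∘₁-assoc ((γ ◆ β) ◆ α) ≡ γ ◆ (β ◆ α)
    ◆-idˡ : ∀ {A B} {f f' : Hom A B} {α : Cell f f'} →
            subst₂ Cell ∘₁-idˡ ∘₁-idˡ (id₂ {f = id₁} ◆ α) ≡ α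
    ◆-idʳ : ∀ {A B} {f f' : Hom A B} {α : Cell f f'} →
            subst₂ Cell ∘₁-idʳ ∘₁-idʳ (α ◆ id₂ {f = id₁}) ≡ α

record TwoFunctor {o h c o' h' c' : Level}
                  (𝒞 : TwoCategory o h c) (ℬ : TwoCategory o' h' c')
                  : Set (o ⊔ h ⊔ c ⊔ o' ⊔ h' ⊔ c') where
  private
    module C = TwoCategory 𝒞
    module B = TwoCategory ℬ
  field
    F₀ : C.Obj → B.Obj
    F₁ : ∀ {X Y} → C.Hom X Y → B.Hom (F₀ X) (F₀ Y)
    F₂ : ∀ {X Y} {p p' : C.Hom X Y} → C.Cell p p' → B.Cell (F₁ p) (F₁ p')
    F-id₁ : ∀ {X} → F₁ (C.id₁ {X}) ≡ B.id₁
    F-∘ : ∀ {X Y Z} {p : C.Hom X Y} {q : C.Hom Y Z} →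
          F₁ (q C.∘₁ p) ≡ F₁ q B.∘₁ F₁ p
    F-id₂ : ∀ {X Y} {p : C.Hom X Y} → F₂ (C.id₂ {f = p}) ≡ B.id₂
    F-· : ∀ {X Y} {p p' p'' : C.Hom X Y} {θ : C.Cell p p'} {θ' : C.Cell p' p''} →
          F₂ (θ' C.· θ) ≡ F₂ θ' B.· F₂ θ
    F-◆ : ∀ {X Y Z} {p p' : C.Hom X Y} {q q' : C.Hom Y Z}
          {θ : C.Cell p p'} {φ : C.Cell q q'} →
          subst₂ B.Cell F-∘ F-∘ (F₂ (φ C.◆ θ)) ≡ F₂ φ B.◆ F₂ θ

module Fibration {o h c o' h' c' : Level}
                 {𝒞 : TwoCategory o h c} {ℬ : TwoCategory o' h' c'}
                 (F : TwoFunctor 𝒞 ℬ) where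
  private
    module C = TwoCategory 𝒞
    module B = TwoCategory ℬ
  open TwoFunctor F

  -- a 1-cell p : X → Y of 𝒞 lies over f : A → B of ℬ
  -- (its image, together with its boundary, is f with its boundary)
  Over₁ : ∀ {X Y} → C.Hom X Y → ∀ {A B} → B.Hom A B → Set (o' ⊔ h')
  Over₁ {X} {Y} p {A} {B} f =
    _≡_ {A = Σ B.Obj λ U → Σ B.Obj λ V → B.Hom U V}
        (F₀ X , F₀ Y , F₁ p) (A , B , f)

  Over₂ : ∀ {X Y} {p p' : C.Hom X Y} → C.Cell p p' →
          ∀ {A B} {f g : B.Hom A B} → B.Cell f g → Set (o' ⊔ h' ⊔ c')
  Over₂ {X} {Y} {p} {p'} θ {A} {B} {f} {g} α =
    _≡_ {A = Σ B.Obj λ U → Σ B.Obj λ V → Σ (B.Hom U V) λ k → Σ (B.Hom U V) λ l → B.Cell k l}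
        (F₀ X , F₀ Y , F₁ p , F₁ p' , F₂ θ) (A , B , f , g , α)

  -- q : Q → R over g : B → C is cartesian (for the underlying 1-functor)
  IsCartesian : ∀ {Q R} (q : C.Hom Q R) {B' C'} (g : B.Hom B' C') →
                Set (o ⊔ h ⊔ o' ⊔ h')
  IsCartesian {Q} {R} q {B'} g =
    ∀ {P} {A} (f : B.Hom A B') (r : C.Hom P R) → Over₁ r (g B.∘₁ f) →
    ∃! _≡_ (λ (p : C.Hom P Q) → Over₁ p f × (q C.∘₁ p ≡ r))

  IsGrothendieckFibration : Set (o ⊔ h ⊔ o' ⊔ h')
  IsGrothendieckFibration =
    ∀ {B' C'} (g : B.Hom B' C') (R : C.Obj) → F₀ R ≡ C' →
    Σ C.Obj λ Q → Σ (C.Hom Q R) λ q → Over₁ q g × IsCartesian q g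

  HasUnique2CellLifts : Set (o ⊔ h ⊔ c ⊔ o' ⊔ h' ⊔ c')
  HasUnique2CellLifts =
    ∀ {A B} {f g : B.Hom A B} (α : B.Cell f g) {X Y} (p : C.Hom X Y) → Over₁ p f →
    ∃! _≡_ (λ (lift : Σ (C.Hom X Y) λ p' → C.Cell p p') →
             Over₂ (Data.Product.proj₂ lift) α)

  Is1Discrete2Fibration : Set (o ⊔ h ⊔ c ⊔ o' ⊔ h' ⊔ c')
  Is1Discrete2Fibration = IsGrothendieckFibration × HasUnique2CellLifts

module Submission where

-- Lift α along r to the unique 2-cell θ : r ⇒ r'; its codomain r' lies over g ∘ f, so
-- cartesianness of q factors it uniquely as r' = q ∘ p with p over f.  Any other
-- p' carrying a cell r ⇒ q ∘ p' over α yields another lift of α at r, hence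
-- q ∘ p' = r' and p' = p; the same uniqueness of lifts makes the cell unique.

open import Defs
open import Level using (Level)
open import Data.Product using (Σ; _,_; _×_; ∃!)
open import Relation.Binary.PropositionalEquality using (_≡_; refl)

module Unique2CellLifts
    {o h c o' h' c' : Level}
    {𝒞 : TwoCategory o h c} {ℬ : TwoCategory o' h' c'}
    (F : TwoFunctor 𝒞 ℬ) (lifts : Fibration.HasUnique2CellLifts F) where
  private
    module C = TwoCategory 𝒞
    module B = TwoCategory ℬ
  open Fibration F

  Over₂⇒Over₁-cod : ∀ {X Y} {p p' : C.Hom X Y} {θ : C.Cell p p'}
    {A B} {f g : B.Hom A B} {α : B.Cell f g} → Over₂ θ α → Over₁ p' g
  Over₂⇒Over₁-cod refl = refl

  lift-unique : ∀ {X Y} {p p₁ p₂ : C.Hom X Y} {θ₁ : C.Cell p p₁} {θ₂ : C.Cell p p₂}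
    {A B} {f g : B.Hom A B} {α : B.Cell f g} → Over₁ p f →
    Over₂ θ₁ α → Over₂ θ₂ α → _≡_ {A = Σ (C.Hom X Y) (C.Cell p)} (p₁ , θ₁) (p₂ , θ₂)
  lift-unique {p = p} {α = α} p-over θ₁-over θ₂-over
    with lifts α p p-over
  ... | _ , _ , unique with unique θ₁-over | unique θ₂-over
  ...   | refl | refl = refl

  lift-cell-unique : ∀ {X Y} {p p' : C.Hom X Y} {θ θ' : C.Cell p p'}
    {A B} {f g : B.Hom A B} {α : B.Cell f g} → Over₁ p f →
    Over₂ θ α → Over₂ θ' α → θ ≡ θ'
  lift-cell-unique p-over θ-over θ'-over with lift-unique p-over θ-over θ'-over
  ... | refl = refl

  lift-cod-unique : ∀ {X Y} {p p₁ p₂ : C.Hom X Y} {θ₁ : C.Cell p p₁} {θ₂ : C.Cell p p₂}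
    {A B} {f g : B.Hom A B} {α : B.Cell f g} → Over₁ p f →
    Over₂ θ₁ α → Over₂ θ₂ α → p₁ ≡ p₂
  lift-cod-unique p-over θ₁-over θ₂-over with lift-unique p-over θ₁-over θ₂-over
  ... | refl = refl

  retarget-lift : ∀ {X Y} {p p' s : C.Hom X Y} (θ : C.Cell p p')
    {A B} {f g : B.Hom A B} {α : B.Cell f g} →
    Over₂ θ α → s ≡ p' → Σ (C.Cell p s) (λ θ' → Over₂ θ' α)
  retarget-lift θ θ-over refl = θ , θ-over

open Unique2CellLifts

proposition4p2p3 : ∀ {o h c o' h' c' : Level}
    {𝒞 : TwoCategory o h c} {ℬ : TwoCategory o' h' c'}
    (F : TwoFunctor 𝒞 ℬ) → Fibration.Is1Discrete2Fibration F →
    ∀ {A B C : TwoCategory.Obj ℬ}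
      (f : TwoCategory.Hom ℬ A B) (g : TwoCategory.Hom ℬ B C) (k : TwoCategory.Hom ℬ A C)
      (α : TwoCategory.Cell ℬ k (TwoCategory._∘₁_ ℬ g f))
      {P Q R : TwoCategory.Obj 𝒞}
      (q : TwoCategory.Hom 𝒞 Q R) → Fibration.Over₁ F q g → Fibration.IsCartesian F q g →
      (r : TwoCategory.Hom 𝒞 P R) → Fibration.Over₁ F r k →
      ∃! _≡_ (λ (p : TwoCategory.Hom 𝒞 P Q) →
               Fibration.Over₁ F p f ×
               Σ (TwoCategory.Cell 𝒞 r (TwoCategory._∘₁_ 𝒞 q p)) (λ θ → Fibration.Over₂ F θ α))
      × (∀ (p : TwoCategory.Hom 𝒞 P Q) → Fibration.Over₁ F p f →
           (θ θ' : TwoCategory.Cell 𝒞 r (TwoCategory._∘₁_ 𝒞 q p)) →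
           Fibration.Over₂ F θ α → Fibration.Over₂ F θ' α → θ ≡ θ')
proposition4p2p3 F (_ , lifts) f g k α q _ q-cartesian r r-over
  with lifts α r r-over
... | (r' , θ) , θ-over , _
  with q-cartesian f r' (Over₂⇒Over₁-cod F lifts θ-over)
... | p , (p-over , qp≡r') , p-unique =
  ( p , (p-over , retarget-lift F lifts θ θ-over qp≡r')
  , λ { (p'-over , _ , θ'-over) → p-unique (p'-over , lift-cod-unique F lifts r-over θ'-over θ-over) })
  , λ _ _ _ _ → lift-cell-unique F lifts r-over
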